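{- Let $t \ge 3$ be an integer and let $G = G(V,E)$ be a finite simple graph. For each $v \in V$, let $T_v$ be the set of all $t$-cliques of $G$ that intersect the closed neighborhood $\{v\} \cup \{u \in V : uv \in E\}$ of $v$. Then \[ \sum_{v \in V} |T_v| \le \sum_{v \in V} \binom{\deg(v)+1}{t}. \]
   Context: A $t$-clique is a set of $t$ pairwise adjacent vertices. Binomial coefficients $\binom{m}{t}$ are $0$ when $0 \le m < t$. -}

module Defs where

open import Data.Nat using (ℕ; zero; suc)
open import Data.Nat.Properties as ℕP using ()
open import Data.Bool using (Bool; true; false)
open import Data.Bool.Properties as BP using ()
open import Data.Fin using (Fin; zero; suc)
open import Data.Fin.Properties using (all?; any?) renaming (_≟_ to _≟ᶠ_)
open import Data.Fin.Subset using (Subset; _∈_; ∣_∣; inside; outside)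
open import Data.Fin.Subset.Properties using (_∈?_)
open import Data.Vec using ([]; _∷_)
open import Data.List using (List; []; _∷_; _++_; map; filter; length; allFin)
open import Data.Product using (Σ; ∃; _×_; _,_)
open import Data.Sum using (_⊎_)
open import Relation.Nullary using (Dec; ¬_)
open import Relation.Nullary.Decidable using (_×-dec_; _⊎-dec_; _→-dec_; ¬?)
open import Relation.Binary.PropositionalEquality using (_≡_)

record SimpleGraph (n : ℕ) : Set where
  field
    adj    : Fin n → Fin n → Bool
    sym    : ∀ u v → adj u v ≡ adj v u
    irrefl : ∀ v → adj v v ≡ false
open SimpleGraph public

deg : ∀ {n} → SimpleGraph n → Fin n → ℕ
deg {n} G v = length (filter (λ u → adj G v u BP.≟ true) (allFin n))

allSubsets : ∀ n → List (Subset n)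
allSubsets zero    = [] ∷ []
allSubsets (suc n) = map (inside ∷_) (allSubsets n) ++ map (outside ∷_) (allSubsets n)

IsClique : ∀ {n} → SimpleGraph n → ℕ → Subset n → Set
IsClique G t S = (∣ S ∣ ≡ t) × (∀ i j → i ∈ S → j ∈ S → ¬ (i ≡ j) → adj G i j ≡ true)

isClique? : ∀ {n} (G : SimpleGraph n) t (S : Subset n) → Dec (IsClique G t S)
isClique? G t S =
  (∣ S ∣ ℕP.≟ t) ×-dec
  all? (λ i → all? (λ j → (i ∈? S) →-dec ((j ∈? S) →-dec (¬? (i ≟ᶠ j) →-dec (adj G i j BP.≟ true)))))

InClosedNbhd : ∀ {n} → SimpleGraph n → Fin n → Fin n → Set
InClosedNbhd G v u = (u ≡ v) ⊎ (adj G v u ≡ true)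

InT : ∀ {n} → SimpleGraph n → ℕ → Fin n → Subset n → Set
InT G t v S = IsClique G t S × ∃ (λ u → u ∈ S × InClosedNbhd G v u)

inT? : ∀ {n} (G : SimpleGraph n) t v (S : Subset n) → Dec (InT G t v S)
inT? G t v S = isClique? G t S ×-dec any? (λ u → (u ∈? S) ×-dec ((u ≟ᶠ v) ⊎-dec (adj G v u BP.≟ true)))

cardT : ∀ {n} → SimpleGraph n → ℕ → Fin n → ℕ
cardT {n} G t v = length (filter (inT? G t v) (allSubsets n))

{-# OPTIONS --safe #-}
-- Both sides count pairs (v, S): on the left S is a t-clique meeting the closed neighbourhood
-- N[v], on the right S is a t-subset of N[v].  We inject the former into the latter.  A pair with
-- S ⊆ N[v] stays put.  Otherwise v ∉ S and some x ∈ S is not adjacent to v; we trade a neighbour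
-- u ∈ S of v for v itself, sending (v, S) to (u, S - u + v).  The new set lies in N[u] and is not
-- a clique, so it is not the image of a pair that stays.  If two moved pairs (v, S), (v′, S′) with
-- v ≢ v′ have the same image, then S + v = S′ + v′ and v′ is the only non-neighbour of v in S (and
-- vice versa); so both pairs see the same candidate set S ∩ N(v) for u.  Choosing u as its least
-- or its second least element, according to whether v < x, separates them; this needs
-- |S ∩ N(v)| = t - 1 ≥ 2.
module Submission where

open import Defs hiding (sym)
open import Data.Bool using (Bool; true; false)
import Data.Bool.Properties as Bool
open import Data.Empty using (⊥-elim)
open import Data.Fin using (Fin; zero; suc)
open import Data.Fin.Properties using (any?; <-cmp; injective⇒≤) renaming (_≟_ to _≟ᶠ_; _<?_ to _<ᶠ?_)
open import Data.Fin.Subset using (Subset; inside; outside; _∈_; _∉_; _⊆_; ∣_∣; Nonempty)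
open import Data.Fin.Subset.Properties using (_∈?_; _⊆?_; out⊆-⇔; in⊆in-⇔; nonempty?; Empty-unique; ∣⊥∣≡0)
open import Data.List as List using (List; []; _∷_; _++_; map; filter; length; allFin; cartesianProduct)
open import Data.List.Membership.Propositional using () renaming (_∈_ to _∈ₗ_)
open import Data.List.Membership.Propositional.Properties
  using (∈-lookup; ∈-filter⁺; ∈-filter⁻; ∈-map⁺; ∈-map⁻; ∈-++⁺ˡ; ∈-++⁺ʳ; ∈-allFin; ∈-cartesianProduct⁺)
import Data.List.Membership.Setoid.Properties as SetoidMembership
open import Data.List.Properties using (filter-++; filter-≐; filter-none; length-++; map-cong)
import Data.List.Properties as List
import Data.List.Relation.Unary.All as All
open import Data.List.Relation.Unary.Any as Any using (here; there)
open import Data.List.Relation.Unary.Unique.Propositional using (Unique; []; _∷_)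
open import Data.List.Relation.Unary.Unique.Propositional.Properties
  using (filter⁺; map⁺; ++⁺; allFin⁺; cartesianProduct⁺)
open import Data.Nat using (ℕ; zero; suc; _+_; _≤_; _<_)
open import Data.Nat.Combinatorics using (_C_; nCk+nC[k+1]≡[n+1]C[k+1])
open import Data.Nat.ListAction using (sum)
import Data.Nat.Properties as ℕ
open import Data.Product using (∃; _×_; _,_; proj₁; proj₂)
open import Data.Product.Properties using (,-injective; ,-injectiveʳ)
open import Data.Sum using (inj₁; inj₂; [_,_]′)
open import Data.Vec using ([]; _∷_; here; there; tabulate; _[_]≔_)
open import Data.Vec.Properties
  using (∷-injectiveʳ; []=⇒lookup; lookup⇒[]=; lookup∘tabulate; lookup∘update; lookup∘update′;
         []≔-updates; []≔-minimal; []≔-idempotent; []≔-commutes; []≔-lookup)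
open import Function using (_∘_; case_of_)
open import Level using (0ℓ)
open import Function.Bundles using (Equivalence)
open import Relation.Binary.Definitions using (tri<; tri≈; tri>)
open import Relation.Binary.PropositionalEquality
  using (_≡_; _≢_; refl; sym; trans; cong; cong₂; subst; setoid; module ≡-Reasoning)
open import Relation.Nullary using (Dec; yes; no; does; ¬_; contradiction)
open import Relation.Nullary.Decidable using (_×-dec_; _⊎-dec_; ¬?; dec-true; dec-false; decidable-stable)
open import Relation.Unary using (Pred; Decidable)

private
  variable
    A B : Set

lookup-injective : ∀ {xs : List A} → Unique xs → ∀ {i j} → List.lookup xs i ≡ List.lookup xs j → i ≡ j
lookup-injective {xs = _ ∷ _} _     {zero}  {zero}  _  = refl
lookup-injective         (x∉ ∷ _)   {zero}  {suc j} eq = contradiction eq (All.lookup x∉ (∈-lookup j))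
lookup-injective         (x∉ ∷ _)   {suc i} {zero}  eq = contradiction (sym eq) (All.lookup x∉ (∈-lookup i))
lookup-injective         (_ ∷ uniq) {suc i} {suc j} eq = cong suc (lookup-injective uniq eq)

length-≤-injection : ∀ {xs : List A} {ys : List B} (f : A → B) → Unique xs →
  (∀ {x} → x ∈ₗ xs → f x ∈ₗ ys) →
  (∀ {x y} → x ∈ₗ xs → y ∈ₗ xs → f x ≡ f y → x ≡ y) →
  length xs ≤ length ys
length-≤-injection {xs = xs} {ys} f uniq into inj = injective⇒≤ position-injective
  where
  position : Fin (length xs) → Fin (length ys)
  position i = Any.index (into (∈-lookup i))

  position-injective : ∀ {i j} → position i ≡ position j → i ≡ j
  position-injective {i} {j} eq = lookup-injective uniq (inj (∈-lookup i) (∈-lookup j)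
    (SetoidMembership.index-injective (setoid _) (into (∈-lookup i)) (into (∈-lookup j)) eq))

length-filter-≤-injection : ∀ {P : Pred A 0ℓ} {Q : Pred B 0ℓ} (P? : Decidable P) (Q? : Decidable Q)
  {xs : List A} {ys : List B} (f : A → B) → Unique xs → (∀ y → y ∈ₗ ys) →
  (∀ {x} → P x → Q (f x)) → (∀ {x y} → P x → P y → f x ≡ f y → x ≡ y) →
  length (filter P? xs) ≤ length (filter Q? ys)
length-filter-≤-injection {P = P} P? Q? {xs} f uniq complete maps inj =
  length-≤-injection f (filter⁺ P? uniq)
    (λ x∈ → ∈-filter⁺ Q? (complete _) (maps (satisfies x∈)))
    (λ x∈ y∈ → inj (satisfies x∈) (satisfies y∈))
  where
  satisfies : ∀ {x} → x ∈ₗ filter P? xs → P x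
  satisfies x∈ = proj₂ (∈-filter⁻ P? {xs = xs} x∈)

length-filter-≐ : ∀ {P Q : Pred A 0ℓ} (P? : Decidable P) (Q? : Decidable Q) →
  (∀ {x} → P x → Q x) → (∀ {x} → Q x → P x) → ∀ xs → length (filter P? xs) ≡ length (filter Q? xs)
length-filter-≐ P? Q? P⇒Q Q⇒P xs = cong length (filter-≐ P? Q? (P⇒Q , Q⇒P) xs)

length-filter-none : ∀ {P : Pred A 0ℓ} (P? : Decidable P) → (∀ {x} → ¬ P x) → ∀ xs → length (filter P? xs) ≡ 0
length-filter-none P? ¬P xs = cong length (filter-none P? {xs = xs} (All.tabulate (λ _ → ¬P)))

length-filter-map : ∀ {P : Pred B 0ℓ} (P? : Decidable P) (f : A → B) xs →
  length (filter P? (map f xs)) ≡ length (filter (P? ∘ f) xs)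
length-filter-map P? f [] = refl
length-filter-map P? f (x ∷ xs) with does (P? (f x))
... | true  = cong suc (length-filter-map P? f xs)
... | false = length-filter-map P? f xs

length-filter-++ : ∀ {P : Pred A 0ℓ} (P? : Decidable P) xs ys →
  length (filter P? (xs ++ ys)) ≡ length (filter P? xs) + length (filter P? ys)
length-filter-++ P? xs ys = trans (cong length (filter-++ P? xs ys)) (length-++ (filter P? xs))

length-filter-cartesianProduct : ∀ {P : Pred (A × B) 0ℓ} (P? : Decidable P) xs ys →
  length (filter P? (cartesianProduct xs ys)) ≡ sum (map (λ x → length (filter (P? ∘ (x ,_)) ys)) xs)
length-filter-cartesianProduct P? []       ys = refl
length-filter-cartesianProduct P? (x ∷ xs) ys = trans (length-filter-++ P? (map (x ,_) ys) (cartesianProduct xs ys))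
  (cong₂ _+_ (length-filter-map P? (x ,_) ys) (length-filter-cartesianProduct P? xs ys))

-- Counting subsets

∈-allSubsets : ∀ {n} (S : Subset n) → S ∈ₗ allSubsets n
∈-allSubsets []            = here refl
∈-allSubsets (inside ∷ S)  = ∈-++⁺ˡ (∈-map⁺ (inside ∷_) (∈-allSubsets S))
∈-allSubsets (outside ∷ S) = ∈-++⁺ʳ _ (∈-map⁺ (outside ∷_) (∈-allSubsets S))

allSubsets⁺ : ∀ n → Unique (allSubsets n)
allSubsets⁺ zero    = All.[] ∷ []
allSubsets⁺ (suc n) = ++⁺ (map⁺ ∷-injectiveʳ (allSubsets⁺ n)) (map⁺ ∷-injectiveʳ (allSubsets⁺ n)) disjoint
  where
  disjoint : ∀ {S} → ¬ (S ∈ₗ map (inside ∷_) (allSubsets n) × S ∈ₗ map (outside ∷_) (allSubsets n))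
  disjoint (S∈ , S∈′) with ∈-map⁻ (inside ∷_) S∈ | ∈-map⁻ (outside ∷_) S∈′
  ... | _ , _ , refl | _ , _ , ()

SizedSubsetOf : ∀ {n} → ℕ → Subset n → Subset n → Set
SizedSubsetOf k p A = ∣ A ∣ ≡ k × A ⊆ p

sizedSubsetOf? : ∀ {n} k (p : Subset n) → Decidable (SizedSubsetOf k p)
sizedSubsetOf? k p A = (∣ A ∣ ℕ.≟ k) ×-dec (A ⊆? p)

module _ {n k : ℕ} {s : Bool} {p A : Subset n} where

  drop-outside : SizedSubsetOf k (s ∷ p) (outside ∷ A) → SizedSubsetOf k p A
  drop-outside (∣A∣≡k , A⊆p) = ∣A∣≡k , Equivalence.from out⊆-⇔ A⊆p

  add-outside : SizedSubsetOf k p A → SizedSubsetOf k (s ∷ p) (outside ∷ A)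
  add-outside (∣A∣≡k , A⊆p) = ∣A∣≡k , Equivalence.to out⊆-⇔ A⊆p

length-filter-allSubsets : ∀ {n} {P : Pred (Subset (suc n)) 0ℓ} (P? : Decidable P) →
  length (filter P? (allSubsets (suc n)))
    ≡ length (filter (P? ∘ (inside ∷_)) (allSubsets n)) + length (filter (P? ∘ (outside ∷_)) (allSubsets n))
length-filter-allSubsets {n} P? = trans (length-filter-++ P? (map (inside ∷_) (allSubsets n)) _)
  (cong₂ _+_ (length-filter-map P? (inside ∷_) (allSubsets n)) (length-filter-map P? (outside ∷_) (allSubsets n)))

length-filter-sizedSubsetOf : ∀ {n} (p : Subset n) k →
  length (filter (sizedSubsetOf? k p) (allSubsets n)) ≡ ∣ p ∣ C k
length-filter-sizedSubsetOf []                    zero    = refl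
length-filter-sizedSubsetOf []                    (suc k) = refl
length-filter-sizedSubsetOf {suc n} (outside ∷ p) k       = begin
  length (filter (sizedSubsetOf? k (outside ∷ p)) (allSubsets (suc n)))
    ≡⟨ length-filter-allSubsets (sizedSubsetOf? k (outside ∷ p)) ⟩
  length (filter (sizedSubsetOf? k (outside ∷ p) ∘ (inside ∷_)) (allSubsets n))
    + length (filter (sizedSubsetOf? k (outside ∷ p) ∘ (outside ∷_)) (allSubsets n))
    ≡⟨ cong₂ _+_ (length-filter-none (sizedSubsetOf? k (outside ∷ p) ∘ (inside ∷_))
                   (λ (_ , A⊆p) → case A⊆p here of λ ()) (allSubsets n)) refl ⟩
  length (filter (sizedSubsetOf? k (outside ∷ p) ∘ (outside ∷_)) (allSubsets n))
    ≡⟨ length-filter-≐ _ (sizedSubsetOf? k p) drop-outside add-outside (allSubsets n) ⟩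
  length (filter (sizedSubsetOf? k p) (allSubsets n))
    ≡⟨ length-filter-sizedSubsetOf p k ⟩
  ∣ p ∣ C k ∎
  where open ≡-Reasoning
length-filter-sizedSubsetOf {suc n} (inside ∷ p) zero     = begin
  length (filter (sizedSubsetOf? 0 (inside ∷ p)) (allSubsets (suc n)))
    ≡⟨ length-filter-allSubsets (sizedSubsetOf? 0 (inside ∷ p)) ⟩
  length (filter (sizedSubsetOf? 0 (inside ∷ p) ∘ (inside ∷_)) (allSubsets n))
    + length (filter (sizedSubsetOf? 0 (inside ∷ p) ∘ (outside ∷_)) (allSubsets n))
    ≡⟨ cong₂ _+_ (length-filter-none (sizedSubsetOf? 0 (inside ∷ p) ∘ (inside ∷_)) (λ ()) (allSubsets n)) refl ⟩
  length (filter (sizedSubsetOf? 0 (inside ∷ p) ∘ (outside ∷_)) (allSubsets n))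
    ≡⟨ length-filter-≐ _ (sizedSubsetOf? 0 p) drop-outside add-outside (allSubsets n) ⟩
  length (filter (sizedSubsetOf? 0 p) (allSubsets n))
    ≡⟨ length-filter-sizedSubsetOf p 0 ⟩
  1 ∎
  where open ≡-Reasoning
length-filter-sizedSubsetOf {suc n} (inside ∷ p) (suc k)  = begin
  length (filter (sizedSubsetOf? (suc k) (inside ∷ p)) (allSubsets (suc n)))
    ≡⟨ length-filter-allSubsets (sizedSubsetOf? (suc k) (inside ∷ p)) ⟩
  length (filter (sizedSubsetOf? (suc k) (inside ∷ p) ∘ (inside ∷_)) (allSubsets n))
    + length (filter (sizedSubsetOf? (suc k) (inside ∷ p) ∘ (outside ∷_)) (allSubsets n))
    ≡⟨ cong₂ _+_ (length-filter-≐ _ (sizedSubsetOf? k p) drop-inside add-inside (allSubsets n))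
                 (length-filter-≐ _ (sizedSubsetOf? (suc k) p) drop-outside add-outside (allSubsets n)) ⟩
  length (filter (sizedSubsetOf? k p) (allSubsets n)) + length (filter (sizedSubsetOf? (suc k) p) (allSubsets n))
    ≡⟨ cong₂ _+_ (length-filter-sizedSubsetOf p k) (length-filter-sizedSubsetOf p (suc k)) ⟩
  ∣ p ∣ C k + ∣ p ∣ C suc k
    ≡⟨ nCk+nC[k+1]≡[n+1]C[k+1] ∣ p ∣ k ⟩
  suc ∣ p ∣ C suc k ∎
  where
  open ≡-Reasoning
  drop-inside : ∀ {A} → SizedSubsetOf (suc k) (inside ∷ p) (inside ∷ A) → SizedSubsetOf k p A
  drop-inside (∣A∣≡ , A⊆) = ℕ.suc-injective ∣A∣≡ , Equivalence.from in⊆in-⇔ A⊆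
  add-inside : ∀ {A} → SizedSubsetOf k p A → SizedSubsetOf (suc k) (inside ∷ p) (inside ∷ A)
  add-inside (∣A∣≡ , A⊆) = cong suc ∣A∣≡ , Equivalence.to in⊆in-⇔ A⊆

-- Updating and exchanging elements of a subset

module _ {n} {p : Subset n} where

  ∈-[]≔ : ∀ {x y b} → y ≢ x → y ∈ p → y ∈ p [ x ]≔ b
  ∈-[]≔ {x} {y} y≢x = []≔-minimal p y x y≢x

  ∈-[]≔⁻ : ∀ {x y b} → y ≢ x → y ∈ p [ x ]≔ b → y ∈ p
  ∈-[]≔⁻ {x} {y} {b} y≢x y∈ = lookup⇒[]= y p (trans (sym (lookup∘update′ y≢x p b)) ([]=⇒lookup y∈))

  x∉p[x]≔outside : ∀ {x} → x ∉ p [ x ]≔ outside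
  x∉p[x]≔outside {x} x∈ with () ← trans (sym (lookup∘update x p outside)) ([]=⇒lookup x∈)

  x∈p⇒p[x]≔inside≡p : ∀ {x} → x ∈ p → p [ x ]≔ inside ≡ p
  x∈p⇒p[x]≔inside≡p {x} x∈p = trans (cong (p [ x ]≔_) (sym ([]=⇒lookup x∈p))) ([]≔-lookup p x)

  x∉p⇒p[x]≔outside≡p : ∀ {x} → x ∉ p → p [ x ]≔ outside ≡ p
  x∉p⇒p[x]≔outside≡p {x} x∉p =
    trans (cong (p [ x ]≔_) (sym (Bool.¬-not (x∉p ∘ lookup⇒[]= x p)))) ([]≔-lookup p x)

x∈p⇒1+∣p[x]≔outside∣≡∣p∣ : ∀ {n} {p : Subset n} {x} → x ∈ p → suc ∣ p [ x ]≔ outside ∣ ≡ ∣ p ∣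
x∈p⇒1+∣p[x]≔outside∣≡∣p∣ {p = inside ∷ p}  here        = refl
x∈p⇒1+∣p[x]≔outside∣≡∣p∣ {p = inside ∷ p}  (there x∈p) = cong suc (x∈p⇒1+∣p[x]≔outside∣≡∣p∣ x∈p)
x∈p⇒1+∣p[x]≔outside∣≡∣p∣ {p = outside ∷ p} (there x∈p) = x∈p⇒1+∣p[x]≔outside∣≡∣p∣ x∈p

x∉p⇒∣p[x]≔inside∣≡1+∣p∣ : ∀ {n} {p : Subset n} {x} → x ∉ p → ∣ p [ x ]≔ inside ∣ ≡ suc ∣ p ∣
x∉p⇒∣p[x]≔inside∣≡1+∣p∣ {p = inside ∷ p}  {zero}  x∉p = contradiction here x∉p
x∉p⇒∣p[x]≔inside∣≡1+∣p∣ {p = outside ∷ p} {zero}  _   = refl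
x∉p⇒∣p[x]≔inside∣≡1+∣p∣ {p = inside ∷ p}  {suc x} x∉p = cong suc (x∉p⇒∣p[x]≔inside∣≡1+∣p∣ (x∉p ∘ there))
x∉p⇒∣p[x]≔inside∣≡1+∣p∣ {p = outside ∷ p} {suc x} x∉p = x∉p⇒∣p[x]≔inside∣≡1+∣p∣ (x∉p ∘ there)

∣tabulate∣ : ∀ {n} {A : Set} (f : A → Bool) (g : Fin n → A) →
  ∣ tabulate (f ∘ g) ∣ ≡ length (filter (λ a → f a Bool.≟ true) (List.tabulate g))
∣tabulate∣ {zero}  f g = refl
∣tabulate∣ {suc n} f g with f (g zero)
... | true  = cong suc (∣tabulate∣ f (g ∘ suc))
... | false = ∣tabulate∣ f (g ∘ suc)

nonempty : ∀ {n} (p : Subset n) → 0 < ∣ p ∣ → Nonempty p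
nonempty {n} p 0<∣p∣ with nonempty? p
... | yes ne    = ne
... | no  empty = contradiction (trans (cong ∣_∣ (Empty-unique empty)) (∣⊥∣≡0 n)) (ℕ.>⇒≢ 0<∣p∣)

∃-third : ∀ {n} {p : Subset n} {a b} → a ∈ p → b ∈ p → a ≢ b → 3 ≤ ∣ p ∣ →
  ∃ λ i → i ∈ p × i ≢ a × i ≢ b
∃-third {p = p} {a} {b} a∈p b∈p a≢b 3≤∣p∣ with nonempty rest (ℕ.+-cancelˡ-≤ 2 1 ∣ rest ∣ 3≤2+∣rest∣)
  where
  rest : Subset _
  rest = p [ a ]≔ outside [ b ]≔ outside
  3≤2+∣rest∣ : 3 ≤ 2 + ∣ rest ∣
  3≤2+∣rest∣ = subst (3 ≤_) (sym (trans (cong suc (x∈p⇒1+∣p[x]≔outside∣≡∣p∣ (∈-[]≔ (a≢b ∘ sym) b∈p)))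
                                         (x∈p⇒1+∣p[x]≔outside∣≡∣p∣ a∈p))) 3≤∣p∣
... | i , i∈rest = i , ∈-[]≔⁻ i≢a (∈-[]≔⁻ i≢b i∈rest) , i≢a , i≢b
  where
  i≢b : i ≢ b
  i≢b refl = x∉p[x]≔outside i∈rest
  i≢a : i ≢ a
  i≢a refl = x∉p[x]≔outside (∈-[]≔⁻ i≢b i∈rest)

exchange : ∀ {n} → Subset n → Fin n → Fin n → Subset n
exchange S u v = S [ u ]≔ outside [ v ]≔ inside

module _ {n} {S : Subset n} {u v : Fin n} where

  v∈exchange : v ∈ exchange S u v
  v∈exchange = []≔-updates (S [ u ]≔ outside) v

  ∈-exchange⁺ : ∀ {i} → i ∈ S → i ≢ u → i ∈ exchange S u v
  ∈-exchange⁺ {i} i∈S i≢u with i ≟ᶠ v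
  ... | yes refl = v∈exchange
  ... | no  i≢v  = ∈-[]≔ i≢v (∈-[]≔ i≢u i∈S)

  ∈-exchange⁻ : ∀ {i} → i ∈ exchange S u v → i ≢ v → i ∈ S × i ≢ u
  ∈-exchange⁻ {i} i∈ i≢v = ∈-[]≔⁻ i≢u i∈S[u]≔outside , i≢u
    where
    i∈S[u]≔outside : i ∈ S [ u ]≔ outside
    i∈S[u]≔outside = ∈-[]≔⁻ i≢v i∈
    i≢u : i ≢ u
    i≢u refl = x∉p[x]≔outside i∈S[u]≔outside

  module _ (u∈S : u ∈ S) (v∉S : v ∉ S) where

    u≢v : u ≢ v
    u≢v refl = v∉S u∈S

    ∣exchange∣ : ∣ exchange S u v ∣ ≡ ∣ S ∣
    ∣exchange∣ = trans (x∉p⇒∣p[x]≔inside∣≡1+∣p∣ (v∉S ∘ ∈-[]≔⁻ (u≢v ∘ sym)))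
                       (x∈p⇒1+∣p[x]≔outside∣≡∣p∣ u∈S)

    exchange-inverse : exchange (exchange S u v) v u ≡ S
    exchange-inverse = begin
      S [ u ]≔ outside [ v ]≔ inside [ v ]≔ outside [ u ]≔ inside
        ≡⟨ cong (_[ u ]≔ inside) ([]≔-idempotent (S [ u ]≔ outside) v) ⟩
      S [ u ]≔ outside [ v ]≔ outside [ u ]≔ inside
        ≡⟨ []≔-commutes (S [ u ]≔ outside) v u (u≢v ∘ sym) ⟩
      S [ u ]≔ outside [ u ]≔ inside [ v ]≔ outside
        ≡⟨ cong (_[ v ]≔ outside) (trans ([]≔-idempotent S u) (x∈p⇒p[x]≔inside≡p u∈S)) ⟩
      S [ v ]≔ outside
        ≡⟨ x∉p⇒p[x]≔outside≡p v∉S ⟩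
      S ∎
      where open ≡-Reasoning

-- The rerooting injection

choose : ∀ {P : Set} → Dec P → A → List A → A
choose (yes _) a _       = a
choose (no _)  a []      = a
choose (no _)  _ (b ∷ _) = b

choose-∈ : ∀ {P : Set} (d : Dec P) (a : A) bs → choose d a bs ∈ₗ a ∷ bs
choose-∈ (yes _) a bs       = here refl
choose-∈ (no _)  a []       = here refl
choose-∈ (no _)  a (b ∷ bs) = there (here refl)

choose≡⇒does≡ : ∀ {P Q : Set} (d : Dec P) (e : Dec Q) {a b : A} {bs} → Unique (a ∷ bs) → b ∈ₗ bs →
  choose d a bs ≡ choose e a bs → does d ≡ does e
choose≡⇒does≡ (yes _) (yes _) _ _ _ = refl
choose≡⇒does≡ (no _)  (no _)  _ _ _ = refl
choose≡⇒does≡ (yes _) (no _)  {bs = _ ∷ _} (a∉ ∷ _) _ eq = contradiction eq (All.head a∉)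
choose≡⇒does≡ (no _)  (yes _) {bs = _ ∷ _} (a∉ ∷ _) _ eq = contradiction (sym eq) (All.head a∉)

<?-flip : ∀ {n} {i j : Fin n} → i ≢ j → does (i <ᶠ? j) ≢ does (j <ᶠ? i)
<?-flip {i = i} {j} i≢j eq with <-cmp i j
... | tri< i<j _   j≮i =
  contradiction (trans (sym (dec-true (i <ᶠ? j) i<j)) (trans eq (dec-false (j <ᶠ? i) j≮i))) λ ()
... | tri≈ _   i≡j _   = i≢j i≡j
... | tri> i≮j _   j<i =
  contradiction (trans (sym (dec-false (i <ᶠ? j) i≮j)) (trans eq (dec-true (j <ᶠ? i) j<i))) λ ()

module _ {n} (G : SimpleGraph n) where

  IsComplete : Subset n → Set
  IsComplete S = ∀ i j → i ∈ S → j ∈ S → i ≢ j → adj G i j ≡ true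

  inClosedNbhd? : ∀ v u → Dec (InClosedNbhd G v u)
  inClosedNbhd? v u = (u ≟ᶠ v) ⊎-dec (adj G v u Bool.≟ true)

  closedNbhd : Fin n → Subset n
  closedNbhd v = tabulate (adj G v) [ v ]≔ inside

  ∈-closedNbhd : ∀ {v u} → InClosedNbhd G v u → u ∈ closedNbhd v
  ∈-closedNbhd {v} (inj₁ refl) = []≔-updates (tabulate (adj G v)) v
  ∈-closedNbhd {v} {u} (inj₂ adj-vu) with u ≟ᶠ v
  ... | yes refl = []≔-updates (tabulate (adj G v)) v
  ... | no  u≢v  = ∈-[]≔ u≢v (lookup⇒[]= u (tabulate (adj G v)) (trans (lookup∘tabulate (adj G v) u) adj-vu))

  ∣closedNbhd∣ : ∀ v → ∣ closedNbhd v ∣ ≡ suc (deg G v)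
  ∣closedNbhd∣ v = trans (x∉p⇒∣p[x]≔inside∣≡1+∣p∣ v∉nbhd) (cong suc (∣tabulate∣ (adj G v) (λ u → u)))
    where
    v∉nbhd : v ∉ tabulate (adj G v)
    v∉nbhd v∈ with () ← trans (sym (irrefl G v)) (trans (sym (lookup∘tabulate (adj G v) v)) ([]=⇒lookup v∈))

  isCandidate? : ∀ v S → Decidable (λ i → i ∈ S × adj G v i ≡ true)
  isCandidate? v S i = (i ∈? S) ×-dec (adj G v i Bool.≟ true)

  candidates : Fin n → Subset n → List (Fin n)
  candidates v S = filter (isCandidate? v S) (allFin n)

  nonNeighbour? : ∀ v S → Dec (∃ λ x → x ∈ S × ¬ InClosedNbhd G v x)
  nonNeighbour? v S = any? (λ x → (x ∈? S) ×-dec ¬? (inClosedNbhd? v x))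

  rerootWith : ∀ v S → Dec (∃ λ x → x ∈ S × ¬ InClosedNbhd G v x) → List (Fin n) → Fin n × Subset n
  rerootWith v S (yes (x , _)) (u₁ ∷ us) = let u = choose (v <ᶠ? x) u₁ us in u , exchange S u v
  rerootWith v S _             _         = v , S

  reroot : Fin n × Subset n → Fin n × Subset n
  reroot (v , S) = rerootWith v S (nonNeighbour? v S) (candidates v S)

  record Rerooting (v : Fin n) (S : Subset n) : Set where
    field
      x           : Fin n
      x∈S         : x ∈ S
      x∉N[v]      : ¬ InClosedNbhd G v x
      u₁          : Fin n
      us          : List (Fin n)
      candidates≡ : candidates v S ≡ u₁ ∷ us

    u : Fin n
    u = choose (v <ᶠ? x) u₁ us

  data RerootView (v : Fin n) (S : Subset n) (image : Fin n × Subset n) : Set where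
    stays : image ≡ (v , S) → S ⊆ closedNbhd v → RerootView v S image
    moves : (r : Rerooting v S) → image ≡ (Rerooting.u r , exchange S (Rerooting.u r) v) → RerootView v S image

  rerootView : ∀ {t v S} → InT G t v S → RerootView v S (reroot (v , S))
  rerootView {v = v} {S} ((_ , complete) , w , w∈S , w∈N[v]) = view (nonNeighbour? v S) (candidates v S) refl
    where
    view : ∀ d cs → candidates v S ≡ cs → RerootView v S (rerootWith v S d cs)
    view (no ∄x) _ _ = stays refl λ {i} i∈S →
      ∈-closedNbhd (decidable-stable (inClosedNbhd? v i) λ i∉N[v] → ∄x (i , i∈S , i∉N[v]))
    view (yes (x , x∈S , x∉N[v])) (u₁ ∷ us) candidates≡ =
      moves (record { x = x ; x∈S = x∈S ; x∉N[v] = x∉N[v] ; u₁ = u₁ ; us = us ; candidates≡ = candidates≡ }) refl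
    view (yes (x , x∈S , x∉N[v])) [] candidates≡ = ⊥-elim ([ w≢v , ¬adj-vw ]′ w∈N[v])
      where
      w≢v : w ≢ v
      w≢v w≡v = x∉N[v] (inj₂ (complete v x (subst (_∈ S) w≡v w∈S) x∈S λ v≡x → x∉N[v] (inj₁ (sym v≡x))))
      ¬adj-vw : adj G v w ≢ true
      ¬adj-vw adj-vw =
        case subst (w ∈ₗ_) candidates≡ (∈-filter⁺ (isCandidate? v S) (∈-allFin w) (w∈S , adj-vw)) of λ ()

  module RerootingProperties {v S} (complete : IsComplete S) (r : Rerooting v S) where
    open Rerooting r public

    x≢v : x ≢ v
    x≢v = x∉N[v] ∘ inj₁

    ¬adj-vx : adj G v x ≢ true
    ¬adj-vx = x∉N[v] ∘ inj₂

    v∉S : v ∉ S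
    v∉S v∈S = ¬adj-vx (complete v x v∈S x∈S (x≢v ∘ sym))

    candidate⁻ : ∀ {i} → i ∈ₗ u₁ ∷ us → i ∈ S × adj G v i ≡ true
    candidate⁻ i∈ = proj₂ (∈-filter⁻ (isCandidate? v S) {xs = allFin n} (subst (_ ∈ₗ_) (sym candidates≡) i∈))

    candidate⁺ : ∀ {i} → i ∈ S × adj G v i ≡ true → i ∈ₗ u₁ ∷ us
    candidate⁺ {i} c = subst (i ∈ₗ_) candidates≡ (∈-filter⁺ (isCandidate? v S) (∈-allFin i) c)

    candidates-unique : Unique (u₁ ∷ us)
    candidates-unique = subst Unique candidates≡ (filter⁺ (isCandidate? v S) (allFin⁺ n))

    x≢u₁ : x ≢ u₁
    x≢u₁ x≡u₁ = ¬adj-vx (subst (λ y → adj G v y ≡ true) (sym x≡u₁) (proj₂ (candidate⁻ (here refl))))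

    u∈S : u ∈ S
    u∈S = proj₁ (candidate⁻ (choose-∈ (v <ᶠ? x) u₁ us))

    adj-vu : adj G v u ≡ true
    adj-vu = proj₂ (candidate⁻ (choose-∈ (v <ᶠ? x) u₁ us))

    x≢u : x ≢ u
    x≢u x≡u = ¬adj-vx (subst (λ y → adj G v y ≡ true) (sym x≡u) adj-vu)

    ∣exchange∣≡∣S∣ : ∣ exchange S u v ∣ ≡ ∣ S ∣
    ∣exchange∣≡∣S∣ = ∣exchange∣ u∈S v∉S

    exchange⊆closedNbhd : exchange S u v ⊆ closedNbhd u
    exchange⊆closedNbhd {i} i∈ = ∈-closedNbhd (inj₂ adj-ui)
      where
      adj-ui : adj G u i ≡ true
      adj-ui with i ≟ᶠ v
      ... | yes refl = trans (SimpleGraph.sym G u v) adj-vu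
      ... | no  i≢v  = let (i∈S , i≢u) = ∈-exchange⁻ i∈ i≢v in complete u i u∈S i∈S (i≢u ∘ sym)

    exchange-incomplete : ¬ IsComplete (exchange S u v)
    exchange-incomplete complete′ = ¬adj-vx (complete′ v x v∈exchange (∈-exchange⁺ x∈S x≢u) (x≢v ∘ sym))

  -- Here S + v = S′ + v′, and {v, v′} is the only non-edge of this set.
  module Collision {v v′ S S′} (complete : IsComplete S) (complete′ : IsComplete S′)
                   (r : Rerooting v S) (r′ : Rerooting v′ S′) (v≢v′ : v ≢ v′)
                   (same-u : Rerooting.u r ≡ Rerooting.u r′)
                   (same-exchange : exchange S (Rerooting.u r) v ≡ exchange S′ (Rerooting.u r′) v′) where
    open RerootingProperties complete r
    private module R′ = RerootingProperties complete′ r′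

    v′∈S : v′ ∈ S
    v′∈S = proj₁ (∈-exchange⁻ (subst (v′ ∈_) (sym same-exchange) v∈exchange) (v≢v′ ∘ sym))

    v∈S′ : v ∈ S′
    v∈S′ = proj₁ (∈-exchange⁻ (subst (v ∈_) same-exchange v∈exchange) v≢v′)

    ∈S⇒∈S′ : ∀ {i} → i ∈ S → i ≢ v′ → i ∈ S′
    ∈S⇒∈S′ {i} i∈S i≢v′ with i ≟ᶠ u
    ... | yes i≡u = subst (_∈ S′) (trans (sym same-u) (sym i≡u)) R′.u∈S
    ... | no  i≢u = proj₁ (∈-exchange⁻ (subst (i ∈_) same-exchange (∈-exchange⁺ i∈S i≢u)) i≢v′)

    adj-v : ∀ {i} → i ∈ S → i ≢ v′ → adj G v i ≡ true
    adj-v i∈S i≢v′ = complete′ v _ v∈S′ (∈S⇒∈S′ i∈S i≢v′) λ v≡i → v∉S (subst (_∈ S) (sym v≡i) i∈S)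

    x≡v′ : x ≡ v′
    x≡v′ with x ≟ᶠ v′
    ... | yes x≡v′ = x≡v′
    ... | no  x≢v′ = contradiction (adj-v x∈S x≢v′) ¬adj-vx

    candidate⇒ : ∀ {i} → i ∈ S × adj G v i ≡ true → i ∈ S′ × adj G v′ i ≡ true
    candidate⇒ {i} (i∈S , adj-vi) = ∈S⇒∈S′ i∈S i≢v′ , complete v′ i v′∈S i∈S (i≢v′ ∘ sym)
      where
      i≢v′ : i ≢ v′
      i≢v′ i≡v′ = ¬adj-vx (subst (λ y → adj G v y ≡ true) (trans i≡v′ (sym x≡v′)) adj-vi)

    -- The only use of t ≥ 3.
    second-candidate : 3 ≤ ∣ S ∣ → ∃ λ i → i ∈ₗ us
    second-candidate 3≤∣S∣ with ∃-third x∈S (proj₁ (candidate⁻ (here refl))) x≢u₁ 3≤∣S∣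
    ... | i , i∈S , i≢x , i≢u₁ with candidate⁺ (i∈S , adj-v i∈S λ i≡v′ → i≢x (trans i≡v′ (sym x≡v′)))
    ...   | here i≡u₁  = contradiction i≡u₁ i≢u₁
    ...   | there i∈us = i , i∈us

  collision : ∀ {v v′ S S′} → 3 ≤ ∣ S ∣ → IsComplete S → IsComplete S′ →
    (r : Rerooting v S) (r′ : Rerooting v′ S′) → v ≢ v′ → Rerooting.u r ≡ Rerooting.u r′ →
    exchange S (Rerooting.u r) v ≢ exchange S′ (Rerooting.u r′) v′
  collision {v} {v′} 3≤∣S∣ complete complete′ r r′ v≢v′ same-u same-exchange =
    <?-flip v≢v′ (choose≡⇒does≡ (v <ᶠ? v′) (v′ <ᶠ? v) R.candidates-unique
                                (proj₂ (C.second-candidate 3≤∣S∣)) (begin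
      choose (v <ᶠ? v′) R.u₁ R.us   ≡⟨ cong (λ y → choose (v <ᶠ? y) R.u₁ R.us) (sym C.x≡v′) ⟩
      R.u                           ≡⟨ same-u ⟩
      R′.u                          ≡⟨ cong (λ y → choose (v′ <ᶠ? y) R′.u₁ R′.us) C′.x≡v′ ⟩
      choose (v′ <ᶠ? v) R′.u₁ R′.us ≡⟨ cong₂ (choose (v′ <ᶠ? v)) (List.∷-injectiveˡ same-candidates)
                                                            (List.∷-injectiveʳ same-candidates) ⟨
      choose (v′ <ᶠ? v) R.u₁ R.us   ∎))
    where
    open ≡-Reasoning
    module R  = RerootingProperties complete r
    module R′ = RerootingProperties complete′ r′
    module C  = Collision complete complete′ r r′ v≢v′ same-u same-exchange
    module C′ = Collision complete′ complete r′ r (v≢v′ ∘ sym) (sym same-u) (sym same-exchange)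
    same-candidates : R.u₁ ∷ R.us ≡ R′.u₁ ∷ R′.us
    same-candidates = trans (sym R.candidates≡)
      (trans (filter-≐ (isCandidate? v _) (isCandidate? v′ _) (C.candidate⇒ , C′.candidate⇒) (allFin n))
             R′.candidates≡)

  NbhdSubset : ℕ → Fin n × Subset n → Set
  NbhdSubset t (w , A) = SizedSubsetOf t (closedNbhd w) A

  reroot-sound : ∀ {t v S} → InT G t v S → NbhdSubset t (reroot (v , S))
  reroot-sound T@((∣S∣≡t , complete) , _) with rerootView T
  ... | stays image≡ S⊆N[v] = subst (NbhdSubset _) (sym image≡) (∣S∣≡t , S⊆N[v])
  ... | moves r image≡ = subst (NbhdSubset _) (sym image≡)
                           (trans R.∣exchange∣≡∣S∣ ∣S∣≡t , R.exchange⊆closedNbhd)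
    where module R = RerootingProperties complete r

  reroot-injective : ∀ {t v v′ S S′} → 3 ≤ t → InT G t v S → InT G t v′ S′ →
    reroot (v , S) ≡ reroot (v′ , S′) → (v , S) ≡ (v′ , S′)
  reroot-injective {v = v} {v′} {S} {S′} 3≤t T@((∣S∣≡t , complete) , _) T′@((_ , complete′) , _) same-image
    with rerootView T | rerootView T′
  ... | stays image≡ _ | stays image′≡ _ = trans (sym image≡) (trans same-image image′≡)
  ... | stays image≡ _ | moves r′ image′≡ =
    ⊥-elim (RerootingProperties.exchange-incomplete complete′ r′
      (subst IsComplete (,-injectiveʳ (trans (sym image≡) (trans same-image image′≡))) complete))
  ... | moves r image≡ | stays image′≡ _ =
    ⊥-elim (RerootingProperties.exchange-incomplete complete r
      (subst IsComplete (,-injectiveʳ (trans (sym image′≡) (trans (sym same-image) image≡))) complete′))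
  ... | moves r image≡ | moves r′ image′≡ with ,-injective (trans (sym image≡) (trans same-image image′≡))
  ...   | same-u , same-exchange with v ≟ᶠ v′
  ...     | no  v≢v′ =
    ⊥-elim (collision (subst (3 ≤_) (sym ∣S∣≡t) 3≤t) complete complete′ r r′ v≢v′ same-u same-exchange)
  ...     | yes refl = cong (v ,_) (begin
    S                                   ≡⟨ exchange-inverse R.u∈S R.v∉S ⟨
    exchange (exchange S R.u v) v R.u   ≡⟨ cong₂ (λ A w → exchange A v w) same-exchange same-u ⟩
    exchange (exchange S′ R′.u v) v R′.u ≡⟨ exchange-inverse R′.u∈S R′.v∉S ⟩
    S′                                  ∎)
    where
    open ≡-Reasoning
    module R  = RerootingProperties complete r
    module R′ = RerootingProperties complete′ r′

lemma2 : (t : ℕ) → 3 ≤ t → (n : ℕ) → (G : SimpleGraph n) →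
    sum (map (cardT G t) (allFin n)) ≤ sum (map (λ v → (deg G v + 1) C t) (allFin n))
lemma2 t 3≤t n G = begin
  sum (map (cardT G t) (allFin n))
    ≡⟨ length-filter-cartesianProduct inT-pair? (allFin n) (allSubsets n) ⟨
  length (filter inT-pair? pairs)
    ≤⟨ length-filter-≤-injection inT-pair? nbhdSubset? (reroot G) (cartesianProduct⁺ (allFin⁺ n) (allSubsets⁺ n))
         (λ (v , S) → ∈-cartesianProduct⁺ (∈-allFin v) (∈-allSubsets S)) (reroot-sound G) (reroot-injective G 3≤t) ⟩
  length (filter nbhdSubset? pairs)
    ≡⟨ length-filter-cartesianProduct nbhdSubset? (allFin n) (allSubsets n) ⟩
  sum (map (λ v → length (filter (sizedSubsetOf? t (closedNbhd G v)) (allSubsets n))) (allFin n))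
    ≡⟨ cong sum (map-cong #t-subsets (allFin n)) ⟩
  sum (map (λ v → (deg G v + 1) C t) (allFin n)) ∎
  where
  open ℕ.≤-Reasoning
  pairs : List (Fin n × Subset n)
  pairs = cartesianProduct (allFin n) (allSubsets n)

  inT-pair? : Decidable (λ ((v , S) : Fin n × Subset n) → InT G t v S)
  inT-pair? (v , S) = inT? G t v S

  nbhdSubset? : Decidable (NbhdSubset G t)
  nbhdSubset? (w , A) = sizedSubsetOf? t (closedNbhd G w) A

  #t-subsets : ∀ v → length (filter (sizedSubsetOf? t (closedNbhd G v)) (allSubsets n)) ≡ (deg G v + 1) C t
  #t-subsets v = trans (length-filter-sizedSubsetOf (closedNbhd G v) t)
                       (cong (_C t) (trans (∣closedNbhd∣ G v) (ℕ.+-comm 1 (deg G v))))
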